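{- Let $L$ be a finite lattice and $\{L_i\mid i\in I\}$ a finite family of finite lattices such that $L$ is a subdirect product of them, $L\leq \prod_{i\in I}L_i$. Let $c_L$ and $i_L$ be the closure and interior operators on $\prod_{i\in I}L_i$ corresponding to $L$, i.e. $c_L(\mathbf{z})=\bigwedge\{\mathbf{u}\in L\mid \mathbf{z}\leq\mathbf{u}\}$ and $i_L(\mathbf{z})=\bigvee\{\mathbf{u}\in L\mid \mathbf{u}\leq\mathbf{z}\}$. Let $n\geq 1$ and $f\colon L^n\to L$. Then the following are equivalent: (1) $f$ is an aggregation function preserving arbitrary suprema. (2) For each $l\in\{1,\dots,n\}$ there is a system $\{f^l_{ij}\colon L_i\to L_j\mid i,j\in I\}$ of mappings preserving arbitrary suprema such that $\bigvee_{l=1}^n\bigvee_{i\in I}f^l_{ij}(1_{L_i})=1_{L_j}$ for every $j\in I$, and $$f(\mathbf{x})=\bigvee_{l=1}^n c_L\big(F_l(\mathbf{x}(l))\big)\quad\text{for all }\mathbf{x}\in L^n,$$ where $F_l\colon \prod_{i\in I}L_i\to \prod_{i\in I}L_i$ is given by $F_l(\mathbf{z})(j)=\bigvee_{i\in I}f^l_{ij}(\mathbf{z}(i))$ for $j\in I$.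
   Context: $L$ is a subdirect product of $\{L_i\}$ if $L$ is a sublattice of the (componentwise ordered) direct product $\prod_{i\in I}L_i$ and each coordinate projection maps $L$ onto $L_i$. For $\mathbf{x}\in L^n$, $\mathbf{x}(l)\in L\subseteq\prod_i L_i$ is its $l$-th coordinate, and $\mathbf{z}(i)$ is the $i$-th component of $\mathbf{z}\in\prod_i L_i$; $1_{L_i}$ is the top element of $L_i$. An aggregation function $f\colon L^n\to L$ is monotone with $f(0,\dots,0)=0$ and $f(1,\dots,1)=1$ (bottom and top of $L$). Preserving arbitrary suprema includes the empty supremum. -}

module Defs where

open import Level using (0ℓ)
open import Data.Nat using (ℕ; zero; suc)
open import Data.Fin using (Fin; zero; suc)
open import Data.Product using (Σ; ∃; _×_; _,_; proj₁)
open import Relation.Nullary using (Dec)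
open import Relation.Binary.Lattice.Bundles using (BoundedLattice)

Lat : Set₁
Lat = BoundedLattice 0ℓ 0ℓ 0ℓ

module _ (L : Lat) where
  open BoundedLattice L

  bigJoin : {k : ℕ} → (Fin k → Carrier) → Carrier
  bigJoin {zero}  g = ⊥
  bigJoin {suc k} g = g zero ∨ bigJoin (λ i → g (suc i))

Finite : (A : Set) → (A → A → Set) → Set
Finite A _≈_ =
  Σ ℕ λ k → Σ (Fin k → A) λ e → (∀ a → ∃ λ i → e i ≈ a) × (∀ a b → Dec (a ≈ b))

FiniteLat : Lat → Set
FiniteLat L = Finite (BoundedLattice.Carrier L) (BoundedLattice._≈_ L)

module _ {A : Set} (_≤_ : A → A → Set) where
  IsSup : (A → Set) → A → Set
  IsSup S x = (∀ y → S y → y ≤ x) × (∀ w → (∀ y → S y → y ≤ w) → x ≤ w)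

  IsInf : (A → Set) → A → Set
  IsInf S x = (∀ y → S y → x ≤ y) × (∀ w → (∀ y → S y → w ≤ y) → w ≤ x)

  IsLeast : A → Set
  IsLeast x = ∀ y → x ≤ y

  IsGreatest : A → Set
  IsGreatest x = ∀ y → y ≤ x

Image : {A B : Set} → (B → B → Set) → (A → B) → (A → Set) → (B → Set)
Image _≈B_ f S b = ∃ λ a → S a × (b ≈B f a)

PreservesSups : {A B : Set} → (A → A → Set) → (B → B → Set) → (B → B → Set) →
                (A → B) → Set₁
PreservesSups _≤A_ _≈B_ _≤B_ f =
  ∀ (S : _ → Set) x → IsSup _≤A_ S x → IsSup _≤B_ (Image _≈B_ f S) (f x)

Monotone : {A B : Set} → (A → A → Set) → (B → B → Set) → (A → B) → Set
Monotone _≤A_ _≤B_ f = ∀ x y → x ≤A y → f x ≤B f y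

module Product {m : ℕ} (Ls : Fin m → Lat) where
  open BoundedLattice

  Prod : Set
  Prod = (i : Fin m) → Carrier (Ls i)

  _≈ₚ_ : Prod → Prod → Set
  z ≈ₚ u = ∀ i → _≈_ (Ls i) (z i) (u i)

  _≤ₚ_ : Prod → Prod → Set
  z ≤ₚ u = ∀ i → _≤_ (Ls i) (z i) (u i)

  _∨ₚ_ : Prod → Prod → Prod
  (z ∨ₚ u) i = _∨_ (Ls i) (z i) (u i)

  _∧ₚ_ : Prod → Prod → Prod
  (z ∧ₚ u) i = _∧_ (Ls i) (z i) (u i)

  bigJoinₚ : {k : ℕ} → (Fin k → Prod) → Prod
  bigJoinₚ g j = bigJoin (Ls j) (λ l → g l j)

  F : ((i j : Fin m) → Carrier (Ls i) → Carrier (Ls j)) → Prod → Prod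
  F fs z j = bigJoin (Ls j) (λ i → fs i j (z i))

  record IsSubdirect (InL : Prod → Set) : Set where
    field
      respects  : ∀ z u → z ≈ₚ u → InL z → InL u
      nonempty  : ∃ InL
      ∨-closed  : ∀ z u → InL z → InL u → InL (z ∨ₚ u)
      ∧-closed  : ∀ z u → InL z → InL u → InL (z ∧ₚ u)
      onto      : ∀ i (a : Carrier (Ls i)) → ∃ λ u → InL u × _≈_ (Ls i) (u i) a

  module Sub (InL : Prod → Set) where
    Elt : Set
    Elt = Σ Prod InL

    _≈L_ : Elt → Elt → Set
    x ≈L y = proj₁ x ≈ₚ proj₁ y

    _≤L_ : Elt → Elt → Set
    x ≤L y = proj₁ x ≤ₚ proj₁ y

    _≤Lⁿ_ : {n : ℕ} → (Fin n → Elt) → (Fin n → Elt) → Set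
    x ≤Lⁿ y = ∀ l → x l ≤L y l

    IsClosureOf : (Prod → Prod) → Set
    IsClosureOf c = ∀ z → IsInf _≤ₚ_ (λ u → InL u × z ≤ₚ u) (c z)

    IsAggregation : {n : ℕ} → ((Fin n → Elt) → Elt) → Set
    IsAggregation f =
      Monotone _≤Lⁿ_ _≤L_ f
      × (∀ x → (∀ l → IsLeast _≤L_ (x l)) → IsLeast _≤L_ (f x))
      × (∀ x → (∀ l → IsGreatest _≤L_ (x l)) → IsGreatest _≤L_ (f x))

-- Let ι i a be c_L of the tuple that is a at i and ⊥ elsewhere, and single l u the
-- n-tuple that is u at l and ⊥ elsewhere.  Every x ∈ Lⁿ is the join of the tuples
-- single l (x l), and every u ∈ L is the join in L of the ι i (u i).  Hence a
-- sup-preserving f is the join of the values f (single l (ι i a)), which define the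
-- maps f^l_ij; joins of elements of L are computed in the product, and c_L fixes L.
-- Conversely, the formula makes f monotone and reduces its preservation of sups to
-- that of the f^l_ij, because suprema in L are computed coordinatewise: L is finite,
-- so it has an interior operator i_L as well as c_L.
module Submission where

open import Defs
open import Level using (0ℓ)
open import Data.Nat using (ℕ; zero; suc)
open import Data.Fin using (Fin; zero; suc; _≟_)
open import Data.Fin.Properties using (all?)
open import Data.Product using (Σ; ∃; _×_; _,_; proj₁; proj₂)
open import Data.Unit using (tt)
open import Data.Empty using (⊥-elim)
open import Function using (_∘_)
open import Function.Bundles using (_⇔_; mk⇔)
open import Relation.Nullary using (Dec; yes; no)
open import Relation.Unary using (Pred; U; ∅; Decidable)
open import Relation.Binary using (Rel; IsPreorder)
open import Relation.Binary.Definitions using (Reflexive)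
open import Relation.Binary.PropositionalEquality using (_≡_; refl; sym; subst)
import Relation.Binary.Construct.On as On
import Relation.Binary.Reasoning.Setoid as SetoidReasoning
open import Relation.Binary.Lattice.Bundles using (BoundedLattice; JoinSemilattice)
open import Relation.Binary.Lattice.Properties.MeetSemilattice using (dualJoinSemilattice)

module BigJoinProperties (L : Lat) where
  open BoundedLattice L hiding (Carrier; _≈_; ⊤; refl) renaming (_≤_ to _⊑_)
  open BoundedLattice L using () renaming (Carrier to A; _≈_ to _≃_; refl to ⊑-refl)

  bigJoin-ub : ∀ {k} (g : Fin k → A) i → g i ⊑ bigJoin L g
  bigJoin-ub g zero    = x≤x∨y _ _
  bigJoin-ub g (suc i) = trans (bigJoin-ub (g ∘ suc) i) (y≤x∨y _ _)

  bigJoin-least : ∀ {k} (g : Fin k → A) {w} → (∀ i → g i ⊑ w) → bigJoin L g ⊑ w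
  bigJoin-least {zero}  g {w} _ = minimum w
  bigJoin-least {suc k} g gi⊑w  = ∨-least (gi⊑w zero) (bigJoin-least (g ∘ suc) (gi⊑w ∘ suc))

  bigJoin-mono : ∀ {k} {g h : Fin k → A} → (∀ i → g i ⊑ h i) → bigJoin L g ⊑ bigJoin L h
  bigJoin-mono {h = h} g⊑h = bigJoin-least _ (λ i → trans (g⊑h i) (bigJoin-ub h i))

  bigJoin-cong : ∀ {k} {g h : Fin k → A} → (∀ i → g i ≃ h i) → bigJoin L g ≃ bigJoin L h
  bigJoin-cong g≃h =
    antisym (bigJoin-mono (reflexive ∘ g≃h)) (bigJoin-mono (reflexive ∘ Eq.sym ∘ g≃h))

  ≈-dec⇒≤-dec : (∀ a b → Dec (a ≃ b)) → ∀ a b → Dec (a ⊑ b)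
  ≈-dec⇒≤-dec _≟ₗ_ a b with (a ∧ b) ≟ₗ a
  ... | yes a∧b≃a = yes (trans (reflexive (Eq.sym a∧b≃a)) (x∧y≤y a b))
  ... | no  a∧b≄a =
    no (λ a⊑b → a∧b≄a (antisym (x∧y≤x a b) (∧-greatest ⊑-refl a⊑b)))

open BigJoinProperties

module _ {A B : Set} {_≤A_ : Rel A 0ℓ} {_≈B_ _≤B_ : Rel B 0ℓ} {f : A → B}
         (ps : PreservesSups _≤A_ _≈B_ _≤B_ f) where

  preservesSups⇒monotone : Reflexive _≤A_ → Reflexive _≈B_ → Monotone _≤A_ _≤B_ f
  preservesSups⇒monotone ≤-refl ≈-refl x y x≤y =
    proj₁ (ps (_≤A y) y ((λ _ z≤y → z≤y) , (λ _ ub → ub y ≤-refl)))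
          (f x) (x , x≤y , ≈-refl)

  preservesSups⇒least : ∀ {x} → IsLeast _≤A_ x → IsLeast _≤B_ (f x)
  preservesSups⇒least x-least w =
    proj₂ (ps ∅ _ ((λ _ ()) , (λ v _ → x-least v))) w (λ { _ (_ , () , _) })

module _ {k : ℕ} {A : Fin k → Set} where

  update : (i : Fin k) → A i → ((j : Fin k) → A j) → (j : Fin k) → A j
  update i a z j with i ≟ j
  ... | yes refl = a
  ... | no  _    = z j

  update-updates : ∀ i a z → update i a z i ≡ a
  update-updates i a z with i ≟ i
  ... | yes refl = refl
  ... | no  i≢i  = ⊥-elim (i≢i refl)

  update-elim : (P : ∀ j → A j → Set) {i : Fin k} {a : A i} {z : (j : Fin k) → A j} →
                P i a → (∀ j → P j (z j)) → ∀ j → P j (update i a z j)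
  update-elim P {i} Pa Pz j with i ≟ j
  ... | yes refl = Pa
  ... | no  _    = Pz j

module _ {A : Set} {_≈_ _≤_ : Rel A 0ℓ} (isPreorder : IsPreorder _≈_ _≤_) where
  open IsPreorder isPreorder

  sup-component : ∀ {k} (S : Pred (Fin k → A) 0ℓ) x →
                  IsSup (λ s t → ∀ l → s l ≤ t l) S x →
                  ∀ l → IsSup _≤_ (Image _≈_ (λ s → s l) S) (x l)
  sup-component S x (x-ub , x-least) l =
      (λ { a (s , s∈S , a≈sl) → trans (reflexive a≈sl) (x-ub s s∈S l) })
    , λ w w-ub → subst (x l ≤_) (update-updates l w x) (x-least (update l w x) (λ s s∈S →
        update-elim (λ j b → s j ≤ b) (w-ub (s l) (s , s∈S , Eq.refl)) (x-ub s s∈S)) l)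

module FiniteJoins (J : JoinSemilattice 0ℓ 0ℓ 0ℓ) where
  open JoinSemilattice J renaming (refl to ≤-refl)

  ⋁⟨_⟩ : Carrier → ∀ {k} → (Fin k → Carrier) → Carrier
  ⋁⟨ b ⟩ {zero}  g = b
  ⋁⟨ b ⟩ {suc k} g = g zero ∨ ⋁⟨ b ⟩ (g ∘ suc)

  ≤⋁ : ∀ b {k} (g : Fin k → Carrier) t → g t ≤ ⋁⟨ b ⟩ g
  ≤⋁ b g zero    = x≤x∨y _ _
  ≤⋁ b g (suc t) = trans (≤⋁ b (g ∘ suc) t) (y≤x∨y _ _)

  ⋁-least : ∀ {b w k} (g : Fin k → Carrier) →
            b ≤ w → (∀ t → g t ≤ w) → ⋁⟨ b ⟩ g ≤ w
  ⋁-least {k = zero}  g b≤w _   = b≤w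
  ⋁-least {k = suc k} g b≤w g≤w =
    ∨-least (g≤w zero) (⋁-least (g ∘ suc) b≤w (g≤w ∘ suc))

  ⋁-closed : (P : Pred Carrier 0ℓ) → (∀ {x y} → P x → P y → P (x ∨ y)) →
             ∀ {b k} (g : Fin k → Carrier) → P b → (∀ t → P (g t)) → P (⋁⟨ b ⟩ g)
  ⋁-closed P ∨-closed {k = zero}  g Pb _  = Pb
  ⋁-closed P ∨-closed {k = suc k} g Pb Pg =
    ∨-closed (Pg zero) (⋁-closed P ∨-closed (g ∘ suc) Pb (Pg ∘ suc))

  module _ {Q : Pred Carrier 0ℓ} (Q? : Decidable Q) (b : Carrier) where

    keep : Carrier → Carrier
    keep a with Q? a
    ... | yes _ = a
    ... | no  _ = b

    ≤keep : ∀ {a} → Q a → a ≤ keep a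
    ≤keep {a} Qa with Q? a
    ... | yes _  = ≤-refl
    ... | no ¬Qa = ⊥-elim (¬Qa Qa)

    keep-least : ∀ {a w} → b ≤ w → (Q a → a ≤ w) → keep a ≤ w
    keep-least {a} b≤w Qa⇒a≤w with Q? a
    ... | yes Qa = Qa⇒a≤w Qa
    ... | no  _  = b≤w

    keep-elim : (P : Pred Carrier 0ℓ) → ∀ {a} → P a → P b → P (keep a)
    keep-elim P {a} Pa Pb with Q? a
    ... | yes _ = Pa
    ... | no  _ = Pb

module _ {m : ℕ} (Ls : Fin m → Lat) where
  open Product Ls
  private module L i = BoundedLattice (Ls i)

  productLattice : Lat
  productLattice = record
    { Carrier = Prod ; _≈_ = _≈ₚ_ ; _≤_ = _≤ₚ_ ; _∨_ = _∨ₚ_ ; _∧_ = _∧ₚ_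
    ; ⊤ = λ i → L.⊤ i ; ⊥ = λ i → L.⊥ i
    ; isBoundedLattice = record
      { isLattice = record
        { isPartialOrder = record
          { isPreorder = record
            { isEquivalence = record
              { refl  = λ i → L.Eq.refl i
              ; sym   = λ p i → L.Eq.sym i (p i)
              ; trans = λ p q i → L.Eq.trans i (p i) (q i) }
            ; reflexive = λ p i → L.reflexive i (p i)
            ; trans     = λ p q i → L.trans i (p i) (q i) }
          ; antisym = λ p q i → L.antisym i (p i) (q i) }
        ; supremum = λ x y → (λ i → L.x≤x∨y i (x i) (y i))
                           , (λ i → L.y≤x∨y i (x i) (y i))
                           , λ z p q i → L.∨-least i (p i) (q i)
        ; infimum  = λ x y → (λ i → L.x∧y≤x i (x i) (y i))
                           , (λ i → L.x∧y≤y i (x i) (y i))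
                           , λ z p q i → L.∧-greatest i (p i) (q i) }
      ; maximum = λ x i → L.maximum i (x i)
      ; minimum = λ x i → L.minimum i (x i) } }

  bigJoinₚ-ub : ∀ {k} (g : Fin k → Prod) t → g t ≤ₚ bigJoinₚ g
  bigJoinₚ-ub g t j = bigJoin-ub (Ls j) (λ l → g l j) t

  bigJoinₚ-least : ∀ {k} (g : Fin k → Prod) {w} →
                   (∀ t → g t ≤ₚ w) → bigJoinₚ g ≤ₚ w
  bigJoinₚ-least g g≤w j = bigJoin-least (Ls j) _ (λ t → g≤w t j)

  bigJoinₚ-cong : ∀ {k} {g h : Fin k → Prod} →
                  (∀ t → g t ≈ₚ h t) → bigJoinₚ g ≈ₚ bigJoinₚ h
  bigJoinₚ-cong g≈h j = bigJoin-cong (Ls j) (λ t → g≈h t j)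

module Subdirect {m : ℕ} (Ls : Fin m → Lat) (finLs : ∀ i → FiniteLat (Ls i))
                 (InL : Product.Prod Ls → Set) (sd : Product.IsSubdirect Ls InL)
                 (finL : Finite (Product.Sub.Elt Ls InL) (Product.Sub._≈L_ Ls InL)) where
  open Product Ls
  open Product.Sub Ls InL
  open IsSubdirect sd
  private
    module L i = BoundedLattice (Ls i)
    module P = BoundedLattice (productLattice Ls)
    module ∨ₚ = FiniteJoins P.joinSemilattice
    module ∧ₚ = FiniteJoins (dualJoinSemilattice P.meetSemilattice)

    enum : Fin (proj₁ finL) → Elt
    enum = proj₁ (proj₂ finL)

    enum-onto : ∀ u → ∃ λ t → enum t ≈L u
    enum-onto = proj₁ (proj₂ (proj₂ finL))

    ∨-closed′ : ∀ {z u} → InL z → InL u → InL (z ∨ₚ u)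
    ∨-closed′ = ∨-closed _ _

    ∧-closed′ : ∀ {z u} → InL z → InL u → InL (z ∧ₚ u)
    ∧-closed′ = ∧-closed _ _

  _≤ₚ?_ : ∀ z u → Dec (z ≤ₚ u)
  z ≤ₚ? u = all? λ i → ≈-dec⇒≤-dec (Ls i) (proj₂ (proj₂ (proj₂ (finLs i)))) (z i) (u i)

  ⊤≤upperBound : ∀ {w} → (∀ (u : Elt) → proj₁ u ≤ₚ w) → P.⊤ ≤ₚ w
  ⊤≤upperBound u≤w j =
    let u , u∈L , uj≈⊤ = onto j (L.⊤ j) in
    L.trans j (L.reflexive j (L.Eq.sym j uj≈⊤)) (u≤w (u , u∈L) j)

  lowerBound≤⊥ : ∀ {w} → (∀ (u : Elt) → w ≤ₚ proj₁ u) → w ≤ₚ P.⊥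
  lowerBound≤⊥ w≤u j =
    let u , u∈L , uj≈⊥ = onto j (L.⊥ j) in
    L.trans j (w≤u (u , u∈L) j) (L.reflexive j uj≈⊥)

  ⊤∈L : InL P.⊤
  ⊤∈L = respects _ _ (P.antisym (P.maximum _) (⊤≤upperBound u≤⋁))
          (∨ₚ.⋁-closed InL ∨-closed′ _ (proj₂ nonempty) (proj₂ ∘ enum))
    where
    u≤⋁ : ∀ (u : Elt) → proj₁ u ≤ₚ ∨ₚ.⋁⟨ proj₁ nonempty ⟩ (proj₁ ∘ enum)
    u≤⋁ u = let t , et≈u = enum-onto u in
            P.trans (P.reflexive (P.Eq.sym et≈u)) (∨ₚ.≤⋁ _ _ t)

  ⊥∈L : InL P.⊥
  ⊥∈L = respects _ _ (P.antisym (lowerBound≤⊥ ⋀≤u) (P.minimum _))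
          (∧ₚ.⋁-closed InL ∧-closed′ _ (proj₂ nonempty) (proj₂ ∘ enum))
    where
    ⋀≤u : ∀ (u : Elt) → ∧ₚ.⋁⟨ proj₁ nonempty ⟩ (proj₁ ∘ enum) ≤ₚ proj₁ u
    ⋀≤u u = let t , et≈u = enum-onto u in P.trans (∧ₚ.≤⋁ _ _ t) (P.reflexive et≈u)

  ≤L-isPreorder : IsPreorder _≈L_ _≤L_
  ≤L-isPreorder = On.isPreorder proj₁ P.isPreorder

  ⊤L ⊥L : Elt
  ⊤L = P.⊤ , ⊤∈L
  ⊥L = P.⊥ , ⊥∈L

  bigJoinₚ∈L : ∀ {k} (g : Fin k → Elt) → InL (bigJoinₚ (proj₁ ∘ g))
  bigJoinₚ∈L {zero}  g = ⊥∈L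
  bigJoinₚ∈L {suc k} g = ∨-closed _ _ (proj₂ (g zero)) (bigJoinₚ∈L (g ∘ suc))

  interior : Prod → Elt
  interior z = ∨ₚ.⋁⟨ P.⊥ ⟩ (∨ₚ.keep (_≤ₚ? z) P.⊥ ∘ proj₁ ∘ enum)
             , ∨ₚ.⋁-closed InL ∨-closed′ _ ⊥∈L
                 (λ t → ∨ₚ.keep-elim (_≤ₚ? z) P.⊥ InL (proj₂ (enum t)) ⊥∈L)

  interior-≤ : ∀ z → proj₁ (interior z) ≤ₚ z
  interior-≤ z = ∨ₚ.⋁-least (∨ₚ.keep (_≤ₚ? z) P.⊥ ∘ proj₁ ∘ enum) (P.minimum z)
                   (λ t → ∨ₚ.keep-least (_≤ₚ? z) P.⊥ (P.minimum z) (λ u≤z → u≤z))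

  interior-greatest : ∀ {z} (u : Elt) → proj₁ u ≤ₚ z → proj₁ u ≤ₚ proj₁ (interior z)
  interior-greatest {z} u u≤z =
    let t , et≈u = enum-onto u in
    P.trans (P.reflexive (P.Eq.sym et≈u))
            (P.trans (∨ₚ.≤keep (_≤ₚ? z) P.⊥ (P.trans (P.reflexive et≈u) u≤z))
                     (∨ₚ.≤⋁ _ _ t))

  sup-coordinate : ∀ (S : Pred Elt 0ℓ) X → IsSup _≤L_ S X →
                   ∀ j → IsSup (L._≤_ j) (Image (L._≈_ j) (λ s → proj₁ s j) S)
                                            (proj₁ X j)
  -- X lies below the interior of the tuple X with its j-th coordinate replaced by v.
  sup-coordinate S X (X-ub , X-least) j =
      (λ { a (s , s∈S , a≈sj) → L.trans j (L.reflexive j a≈sj) (X-ub s s∈S j) })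
    , λ v v-ub →
        let w = update j v (proj₁ X)
            s≤w : ∀ s → S s → proj₁ s ≤ₚ w
            s≤w s s∈S = update-elim (λ i a → L._≤_ i (proj₁ s i) a)
                          (v-ub (proj₁ s j) (s , s∈S , L.Eq.refl j)) (X-ub s s∈S)
        in L.trans j (X-least (interior w) (λ s s∈S → interior-greatest s (s≤w s s∈S)) j)
                     (subst (L._≤_ j _) (update-updates j v (proj₁ X)) (interior-≤ w j))

  module Closure (c : Prod → Prod) (isC : IsClosureOf c) where

    c-extensive : ∀ z → z ≤ₚ c z
    c-extensive z = proj₂ (isC z) z (λ _ → proj₂)

    c-least : ∀ {z} (u : Elt) → z ≤ₚ proj₁ u → c z ≤ₚ proj₁ u
    c-least u z≤u = proj₁ (isC _) (proj₁ u) (proj₂ u , z≤u)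

    c∈L : ∀ z → InL (c z)
    c∈L z = respects _ _ (P.antisym ⋀≤c c≤⋀) ⋀∈L
      where
      ⋀ : Prod
      ⋀ = ∧ₚ.⋁⟨ P.⊤ ⟩ (∧ₚ.keep (z ≤ₚ?_) P.⊤ ∘ proj₁ ∘ enum)

      ⋀∈L : InL ⋀
      ⋀∈L = ∧ₚ.⋁-closed InL ∧-closed′ _ ⊤∈L
              (λ t → ∧ₚ.keep-elim (z ≤ₚ?_) P.⊤ InL (proj₂ (enum t)) ⊤∈L)

      c≤⋀ : c z ≤ₚ ⋀
      c≤⋀ = c-least (⋀ , ⋀∈L)
              (∧ₚ.⋁-least (∧ₚ.keep (z ≤ₚ?_) P.⊤ ∘ proj₁ ∘ enum) (P.maximum z)
                 (λ t → ∧ₚ.keep-least (z ≤ₚ?_) P.⊤ (P.maximum z) (λ z≤u → z≤u)))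

      ⋀≤c : ⋀ ≤ₚ c z
      ⋀≤c = proj₂ (isC z) ⋀ λ u (u∈L , z≤u) →
        let t , et≈u = enum-onto (u , u∈L) in
        P.trans (∧ₚ.≤⋁ _ _ t)
                (P.trans (∧ₚ.≤keep (z ≤ₚ?_) P.⊤
                           (P.trans z≤u (P.reflexive (P.Eq.sym et≈u))))
                         (P.reflexive et≈u))

    c-fixes-L : ∀ {z} → InL z → c z ≈ₚ z
    c-fixes-L z∈L = P.antisym (c-least (_ , z∈L) P.refl) (c-extensive _)

    ι : (i : Fin m) → L.Carrier i → Elt
    ι i a = c (update i a P.⊥) , c∈L _

    ι-least : ∀ {i a} (u : Elt) → L._≤_ i a (proj₁ u i) → ι i a ≤L u
    ι-least u a≤ui =
      c-least u (update-elim (λ j b → L._≤_ j b (proj₁ u j)) a≤ui (λ j → L.minimum j _))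

    ≤ι : ∀ i a → L._≤_ i a (proj₁ (ι i a) i)
    ≤ι i a = subst (λ b → L._≤_ i b (c (update i a P.⊥) i)) (update-updates i a P.⊥)
                   (c-extensive (update i a P.⊥) i)

    ι-mono : ∀ {i a b} → L._≤_ i a b → ι i a ≤L ι i b
    ι-mono {i} {b = b} a≤b = ι-least (ι i b) (L.trans i a≤b (≤ι i b))

    ι-preservesSups : ∀ i → PreservesSups (L._≤_ i) _≈L_ _≤L_ (ι i)
    ι-preservesSups i T a (a-ub , a-least) =
        (λ { u (t , t∈T , u≈ιt) → P.trans (P.reflexive u≈ιt) (ι-mono (a-ub t t∈T)) })
      , λ w w-ub → ι-least w (a-least (proj₁ w i) (λ t t∈T →
                     L.trans i (≤ι i t) (w-ub (ι i t) (t , t∈T , P.Eq.refl) i)))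

    ι-decomposition : ∀ u → IsSup _≤L_ (Image _≈L_ (λ i → ι i (proj₁ u i)) U) u
    ι-decomposition u =
        (λ { v (i , _ , v≈ι) → P.trans (P.reflexive v≈ι) (ι-least u (L.refl i)) })
      , λ w w-ub i →
          L.trans i (≤ι i (proj₁ u i)) (w-ub (ι i (proj₁ u i)) (i , tt , P.Eq.refl) i)

    module Representation {n : ℕ} (f : (Fin n → Elt) → Elt) where
      open SetoidReasoning P.setoid

      _≈Lⁿ_ : Rel (Fin n → Elt) 0ℓ
      x ≈Lⁿ y = ∀ l → x l ≈L y l

      System : Set
      System = (i j : Fin m) → L.Carrier i → L.Carrier j

      Φ : (Fin n → System) → (Fin n → Elt) → Prod
      Φ fs x = bigJoinₚ (λ l → c (F (fs l) (proj₁ (x l))))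

      SupPreservingAggregation : Set₁
      SupPreservingAggregation = IsAggregation f × PreservesSups _≤Lⁿ_ _≈L_ _≤L_ f

      SupPreserving : System → Set₁
      SupPreserving g = ∀ i j → PreservesSups (L._≤_ i) (L._≈_ j) (L._≤_ j) (g i j)

      ReachesTop : (Fin n → System) → Set
      ReachesTop fs =
        ∀ j → L._≈_ j (bigJoin (Ls j) λ l → bigJoin (Ls j) λ i → fs l i j (L.⊤ i)) (L.⊤ j)

      SystemRepresentation : Set₁
      SystemRepresentation =
        Σ (Fin n → System) λ fs →
          (∀ l → SupPreserving (fs l)) × ReachesTop fs × (∀ x → proj₁ (f x) ≈ₚ Φ fs x)

      single : Fin n → Elt → Fin n → Elt
      single l u = update l u (λ _ → ⊥L)

      single-least : ∀ l {u} w → u ≤L w l → single l u ≤Lⁿ w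
      single-least l w u≤wl =
        update-elim (λ l v → v ≤L w l) u≤wl (λ l → P.minimum (proj₁ (w l)))

      ≤single : ∀ l u → u ≤L single l u l
      ≤single l u = subst (u ≤L_) (sym (update-updates l u _)) P.refl

      single-mono : ∀ l {u v} → u ≤L v → single l u ≤Lⁿ single l v
      single-mono l {v = v} u≤v = single-least l (single l v) (P.trans u≤v (≤single l v))

      single-cong : ∀ l {u v} → u ≈L v → single l u ≈Lⁿ single l v
      single-cong l u≈v k = P.antisym (single-mono l (P.reflexive u≈v) k)
                                      (single-mono l (P.reflexive (P.Eq.sym u≈v)) k)

      single-preservesSups : ∀ l → PreservesSups _≤L_ _≈Lⁿ_ _≤Lⁿ_ (single l)
      single-preservesSups l S u (u-ub , u-least) =
          (λ { x (v , v∈S , x≈sv) k →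
                 P.trans (P.reflexive (x≈sv k)) (single-mono l (u-ub v v∈S) k) })
        , λ w w-ub → single-least l w (u-least (w l) (λ v v∈S →
                       P.trans (≤single l v) (w-ub (single l v) (v , v∈S , λ _ → P.Eq.refl) l)))

      single-decomposition : ∀ x → IsSup _≤Lⁿ_ (Image _≈Lⁿ_ (λ l → single l (x l)) U) x
      single-decomposition x =
          (λ { y (l , _ , y≈) k → P.trans (P.reflexive (y≈ k)) (single-least l x P.refl k) })
        , λ w w-ub l →
            P.trans (≤single l (x l)) (w-ub (single l (x l)) (l , tt , λ _ → P.Eq.refl) l)

      preservesSups⇒bigJoin :
        Monotone _≤Lⁿ_ _≤L_ f → PreservesSups _≤Lⁿ_ _≈L_ _≤L_ f →
        ∀ {S x} → IsSup _≤Lⁿ_ S x → ∀ {k} (g : Fin k → Fin n → Elt) →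
        (∀ t → S (g t)) → (∀ s → S s → ∃ λ t → s ≈Lⁿ g t) →
        proj₁ (f x) ≈ₚ bigJoinₚ (λ t → proj₁ (f (g t)))
      preservesSups⇒bigJoin f-mono f-ps x-sup g g∈S S⊆g =
        P.antisym
          (proj₂ (f-ps _ _ x-sup) (_ , bigJoinₚ∈L (f ∘ g)) λ { b (s , s∈S , b≈fs) →
             let t , s≈gt = S⊆g s s∈S in
             P.trans (P.reflexive b≈fs)
                     (P.trans (f-mono _ _ (P.reflexive ∘ s≈gt)) (bigJoinₚ-ub Ls _ t)) })
          (bigJoinₚ-least Ls _ λ t →
             proj₁ (f-ps _ _ x-sup) (f (g t)) (g t , g∈S t , P.Eq.refl))

      module FromSystem (fs : Fin n → System)
                        (fs-ps : ∀ l → SupPreserving (fs l))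
                        (f≈Φ : ∀ x → proj₁ (f x) ≈ₚ Φ fs x) where

        fs-mono : ∀ {l i j a b} → L._≤_ i a b → L._≤_ j (fs l i j a) (fs l i j b)
        fs-mono {l} {i} {j} =
          preservesSups⇒monotone {_≈B_ = L._≈_ j} (fs-ps l i j) (L.refl i) (L.Eq.refl j) _ _

        system≤f : ∀ x l i j → L._≤_ j (fs l i j (proj₁ (x l) i)) (proj₁ (f x) j)
        system≤f x l i j =
          L.trans j (bigJoin-ub (Ls j) _ i)
            (L.trans j (c-extensive _ j)
              (L.trans j (bigJoin-ub (Ls j) _ l) (L.reflexive j (L.Eq.sym j (f≈Φ x j)))))

        f≤-from-system : ∀ x w → (∀ l i j → L._≤_ j (fs l i j (proj₁ (x l) i)) (proj₁ w j)) →
                         f x ≤L w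
        f≤-from-system x w bound =
          P.trans (P.reflexive (f≈Φ x))
                  (bigJoinₚ-least Ls _ λ l →
                     c-least w (λ j → bigJoin-least (Ls j) _ (λ i → bound l i j)))

        f-mono : Monotone _≤Lⁿ_ _≤L_ f
        f-mono x y x≤y = f≤-from-system x (f y) λ l i j →
          L.trans j (fs-mono (x≤y l i)) (system≤f y l i j)

        f-least : ∀ x → (∀ l → IsLeast _≤L_ (x l)) → IsLeast _≤L_ (f x)
        f-least x x-least w = f≤-from-system x w λ l i j →
          L.trans j (fs-mono (x-least l ⊥L i))
            (preservesSups⇒least {_≈B_ = L._≈_ j} (fs-ps l i j) (L.minimum i) (proj₁ w j))

        f-greatest : ReachesTop fs → ∀ x → (∀ l → IsGreatest _≤L_ (x l)) → IsGreatest _≤L_ (f x)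
        f-greatest fs-⊤ x x-greatest w j =
          L.trans j (L.maximum j _)
            (L.trans j (L.reflexive j (L.Eq.sym j (fs-⊤ j)))
              (bigJoin-least (Ls j) _ λ l → bigJoin-least (Ls j) _ λ i →
                 L.trans j (fs-mono (x-greatest l ⊤L i)) (system≤f x l i j)))

        f-preservesSups : PreservesSups _≤Lⁿ_ _≈L_ _≤L_ f
        f-preservesSups S x x-sup =
            (λ { b (s , s∈S , b≈fs) →
                   P.trans (P.reflexive b≈fs) (f-mono s x (proj₁ x-sup s s∈S)) })
          , λ w w-ub → f≤-from-system x w λ l i j →
              let xli-sup = sup-coordinate (Image _≈L_ (λ s → s l) S) (x l)
                              (sup-component ≤L-isPreorder S x x-sup l) i in
              proj₂ (fs-ps l i j _ _ xli-sup) (proj₁ w j)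
                λ { b (a , (p , (s , s∈S , p≈sl) , a≈pi) , b≈fa) →
                      L.trans j (L.reflexive j b≈fa)
                        (L.trans j (fs-mono (L.reflexive i (L.Eq.trans i a≈pi (p≈sl i))))
                          (L.trans j (system≤f s l i j) (w-ub (f s) (s , s∈S , P.Eq.refl) j))) }

      module ToSystem (f-mono : Monotone _≤Lⁿ_ _≤L_ f)
                      (f-greatest : ∀ x → (∀ l → IsGreatest _≤L_ (x l)) → IsGreatest _≤L_ (f x))
                      (f-ps : PreservesSups _≤Lⁿ_ _≈L_ _≤L_ f) where

        fs : Fin n → System
        fs l i j a = proj₁ (f (single l (ι i a))) j

        f-cong : ∀ {x y} → x ≈Lⁿ y → f x ≈L f y
        f-cong x≈y = P.antisym (f-mono _ _ (P.reflexive ∘ x≈y))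
                               (f-mono _ _ (P.reflexive ∘ P.Eq.sym ∘ x≈y))

        f-decomposition : ∀ x → proj₁ (f x) ≈ₚ bigJoinₚ (λ l → proj₁ (f (single l (x l))))
        f-decomposition x =
          preservesSups⇒bigJoin f-mono f-ps (single-decomposition x) (λ l → single l (x l))
            (λ l → l , tt , λ _ → P.Eq.refl) (λ { s (l , _ , s≈) → l , s≈ })

        f-single : ∀ l u → proj₁ (f (single l u)) ≈ₚ F (fs l) (proj₁ u)
        f-single l u =
          preservesSups⇒bigJoin f-mono f-ps (single-preservesSups l _ u (ι-decomposition u))
            (λ i → single l (ι i (proj₁ u i)))
            (λ i → ι i (proj₁ u i) , (i , tt , P.Eq.refl) , λ _ → P.Eq.refl)
            (λ { s (v , (i , _ , v≈ι) , s≈sv) →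
                   i , λ k → P.Eq.trans (s≈sv k) (single-cong l v≈ι k) })

        F∈L : ∀ l u → InL (F (fs l) (proj₁ u))
        F∈L l u = respects _ _ (f-single l u) (proj₂ (f (single l u)))

        f≈Φ : ∀ x → proj₁ (f x) ≈ₚ Φ fs x
        f≈Φ x = begin
          proj₁ (f x)                                  ≈⟨ f-decomposition x ⟩
          bigJoinₚ (λ l → proj₁ (f (single l (x l)))) ≈⟨ bigJoinₚ-cong Ls (λ l → f-single l (x l)) ⟩
          bigJoinₚ (λ l → F (fs l) (proj₁ (x l)))     ≈⟨ bigJoinₚ-cong Ls (λ l → c-fixes-L (F∈L l (x l))) ⟨
          Φ fs x                                       ∎

        fs-⊤ : ReachesTop fs
        fs-⊤ = begin
          bigJoinₚ (λ l → F (fs l) P.⊤)          ≈⟨ bigJoinₚ-cong Ls (λ l → f-single l ⊤L) ⟨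
          bigJoinₚ (λ l → proj₁ (f (single l ⊤L))) ≈⟨ f-decomposition (λ _ → ⊤L) ⟨
          proj₁ (f (λ _ → ⊤L))                    ≈⟨ P.antisym (P.maximum _) f⊤-greatest ⟩
          P.⊤                                      ∎
          where
          f⊤-greatest : P.⊤ ≤ₚ proj₁ (f (λ _ → ⊤L))
          f⊤-greatest = f-greatest (λ _ → ⊤L) (λ _ u → P.maximum (proj₁ u)) ⊤L

        fs-preservesSups : ∀ l → SupPreserving (fs l)
        fs-preservesSups l i j T a a-sup =
            (λ { b (t , t∈T , b≈) →
                   L.trans j (L.reflexive j b≈)
                     (f-mono _ _ (single-mono l (ι-mono (proj₁ a-sup t t∈T))) j) })
          , λ v v-ub →
              proj₂ (sup-coordinate (Image _≈L_ f S′) (f (single l (ι i a))) (f-ps S′ _ S′-sup) j) v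
                λ { b (p , (s , (u , (t , t∈T , u≈ιt) , s≈su) , p≈fs) , b≈pj) →
                      let s≈ : s ≈Lⁿ single l (ι i t)
                          s≈ k = P.Eq.trans (s≈su k) (single-cong l u≈ιt k)
                      in L.trans j (L.reflexive j (L.Eq.trans j b≈pj (P.Eq.trans p≈fs (f-cong s≈) j)))
                                   (v-ub _ (t , t∈T , L.Eq.refl j)) }
          where
          S′ : Pred (Fin n → Elt) 0ℓ
          S′ = Image _≈Lⁿ_ (single l) (Image _≈L_ (ι i) T)

          S′-sup : IsSup _≤Lⁿ_ S′ (single l (ι i a))
          S′-sup = single-preservesSups l _ _ (ι-preservesSups i T a a-sup)

      fromSystem : SystemRepresentation → SupPreservingAggregation
      fromSystem (fs , fs-ps , fs-⊤ , f≈Φ) =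
        (f-mono , f-least , f-greatest fs-⊤) , f-preservesSups
        where open FromSystem fs fs-ps f≈Φ

      toSystem : SupPreservingAggregation → SystemRepresentation
      toSystem ((f-mono , _ , f-greatest) , f-ps) = fs , fs-preservesSups , fs-⊤ , f≈Φ
        where open ToSystem f-mono f-greatest f-ps

open import Data.Nat using (_≤_)
open BoundedLattice using (Carrier; _≈_; ⊤)
open Product using (Prod; _≈ₚ_; _≤ₚ_; bigJoinₚ; F; IsSubdirect)
open Product.Sub using (Elt; _≈L_; _≤L_; _≤Lⁿ_; IsClosureOf; IsAggregation)

theorem2 : (m : ℕ) (Ls : Fin m → Lat) → (∀ i → FiniteLat (Ls i)) →
           (InL : Prod Ls → Set) → IsSubdirect Ls InL →
           Finite (Elt Ls InL) (_≈L_ Ls InL) →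
           (c : Prod Ls → Prod Ls) → IsClosureOf Ls InL c →
           (n : ℕ) → 1 ≤ n → (f : (Fin n → Elt Ls InL) → Elt Ls InL) →
           ((IsAggregation Ls InL f
             × PreservesSups (_≤Lⁿ_ Ls InL) (_≈L_ Ls InL) (_≤L_ Ls InL) f)
           ⇔
           (Σ ((l : Fin n) → (i j : Fin m) → Carrier (Ls i) → Carrier (Ls j)) λ fs →
              (∀ l i j → PreservesSups (BoundedLattice._≤_ (Ls i)) (_≈_ (Ls j))
                                       (BoundedLattice._≤_ (Ls j)) (fs l i j))
              × (∀ j → _≈_ (Ls j) (bigJoin (Ls j) λ l → bigJoin (Ls j) λ i → fs l i j (⊤ (Ls i)))
                                  (⊤ (Ls j)))
              × (∀ (x : Fin n → Elt Ls InL) →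
                   _≈ₚ_ Ls (proj₁ (f x))
                           (bigJoinₚ Ls λ l → c (F Ls (fs l) (proj₁ (x l)))))))
theorem2 m Ls finLs InL sd finL c isC n _ f = mk⇔ toSystem fromSystem
  where open Subdirect.Closure.Representation Ls finLs InL sd finL c isC f
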